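{- Let $\sigma$ and $a\lambda b\mu$ be sequences of distinct numbers such that $a$ and $b$ are the only two left to right maxima of $a\lambda b\mu$, $\mu$ is non-empty, and $a\lambda b\mu$ is a subsequence of $B(\sigma)$. Let $\pi$ be the permutation order isomorphic to $a\lambda b\mu$. Then $\sigma$ contains a subsequence order isomorphic to one of the members of $R(\pi)$.
   Context: A left to right maximum of a sequence is a term larger than every term preceding it. For any finite sequence of distinct numbers, the operator $B$ is defined recursively by $B(\epsilon)=\epsilon$ and, writing a non-empty sequence as $\sigma=\sigma_1 m\sigma_2$ with $m$ its largest term, $B(\sigma)=B(\sigma_1)\sigma_2 m$. Subsequences need not be consecutive. For a permutation $\pi$ with exactly two left to right maxima that does not end with its largest term, write $\pi=a\alpha n\beta$ where $a$ is the first term, every term of $\alpha$ is less than $a$, $n$ is the largest term, and $\beta$ is non-empty. Then $R(\pi)$ is the set of permutations order isomorphic to some sequence of distinct numbers of the form $a\,x\,\lambda_1\,y\,\lambda_2\,z\,\mu$ or $x\,a\,\lambda_1\,y\,\lambda_2\,z\,\mu$ such that: the subsequence $a\lambda_1\lambda_2 z\mu$ is order isomorphic to $\pi$ (with $a\mapsto a$, $\lambda_1\lambda_2\mapsto\alpha$, $z\mapsto n$, $\mu\mapsto\beta$); $x>a$; $y$ and $z$ are the two largest terms of the sequence (in either order); and $x$ and $y$ may be the same term (in which case $\lambda_1$ is empty), and moreover if $a$ precedes $x$ and $\lambda_1$ is empty then $x$ and $y$ are the same term. -}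

module Defs where

open import Data.Nat using (ℕ; suc; _<_; _<?_)
open import Data.Bool using (if_then_else_)
open import Data.Fin using (Fin; cast)
open import Data.List using (List; []; _∷_; _++_; length; lookup; map; upTo)
open import Data.List.Relation.Unary.All using (All)
open import Data.List.Relation.Unary.Unique.Propositional using (Unique)
open import Data.List.Relation.Binary.Permutation.Propositional using (_↭_)
open import Data.Product using (Σ; Σ-syntax; ∃; ∃-syntax; _×_)
open import Data.Sum using (_⊎_)
open import Function.Bundles using (_⇔_)
open import Relation.Nullary using (¬_; does)
open import Relation.Binary.PropositionalEquality using (_≡_; _≢_)

OrderIso : List ℕ → List ℕ → Set
OrderIso xs ys =
  Σ (length xs ≡ length ys) λ e →
    ∀ (i j : Fin (length xs)) →
      (lookup xs i < lookup xs j) ⇔ (lookup ys (cast e i) < lookup ys (cast e j))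

IsPerm : List ℕ → Set
IsPerm ρ = ρ ↭ map suc (upTo (length ρ))

lrMaxFrom : ℕ → List ℕ → List ℕ
lrMaxFrom m [] = []
lrMaxFrom m (y ∷ ys) = if does (m <? y) then y ∷ lrMaxFrom y ys else lrMaxFrom m ys

lrMaxima : List ℕ → List ℕ
lrMaxima [] = []
lrMaxima (x ∷ xs) = x ∷ lrMaxFrom x xs

-- The operator B, as its (recursive) graph: BRel σ τ means τ = B(σ).
-- B(ε) = ε and B(σ₁ m σ₂) = B(σ₁) σ₂ m with m the largest term.
data BRel : List ℕ → List ℕ → Set where
  B-nil  : BRel [] []
  B-cons : ∀ {s₁ s₂ t m} → All (_< m) s₁ → All (_< m) s₂ →
           BRel s₁ t → BRel (s₁ ++ m ∷ s₂) (t ++ s₂ ++ m ∷ [])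

data Form : Set where
  aFirst xFirst : Form

front : Form → ℕ → ℕ → List ℕ
front aFirst a x = a ∷ x ∷ []
front xFirst a x = x ∷ a ∷ []

-- Sequences of the shape  a x λ₁ y λ₂ z μ  /  x a λ₁ y λ₂ z μ  used in R(π),
-- where π = a₀ α n β.  Two cases: x ≠ y, or x and y the same term (λ₁ empty).
RShape : (a₀ : ℕ) (α : List ℕ) (n : ℕ) (β : List ℕ) → List ℕ → Set
RShape a₀ α n β w =
  Σ[ f ∈ Form ] Σ[ a ∈ ℕ ] Σ[ x ∈ ℕ ] Σ[ λ₂ ∈ List ℕ ] Σ[ z ∈ ℕ ] Σ[ μ ∈ List ℕ ]
    ( Unique w × a < x
    × (
        ( Σ[ λ₁ ∈ List ℕ ] Σ[ y ∈ ℕ ]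
            ( w ≡ front f a x ++ λ₁ ++ y ∷ λ₂ ++ z ∷ μ
            × (f ≡ aFirst → λ₁ ≢ [])
            × length (λ₁ ++ λ₂) ≡ length α
            × OrderIso (a ∷ λ₁ ++ λ₂ ++ z ∷ μ) (a₀ ∷ α ++ n ∷ β)
            × All (λ t → t < y × t < z) (a ∷ x ∷ λ₁ ++ λ₂ ++ μ) ) )
      ⊎
        ( w ≡ front f a x ++ λ₂ ++ z ∷ μ
        × length λ₂ ≡ length α
        × OrderIso (a ∷ λ₂ ++ z ∷ μ) (a₀ ∷ α ++ n ∷ β)
        × All (λ t → t < x × t < z) (a ∷ λ₂ ++ μ) ) ) )

InR : List ℕ → List ℕ → Set
InR π ρ =
  Σ[ a₀ ∈ ℕ ] Σ[ α ∈ List ℕ ] Σ[ n ∈ ℕ ] Σ[ β ∈ List ℕ ]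
    ( π ≡ a₀ ∷ α ++ n ∷ β
    × All (_< a₀) α
    × All (_< n) (a₀ ∷ α ++ β)
    × β ≢ []
    × IsPerm ρ
    × Σ[ w ∈ List ℕ ] (RShape a₀ α n β w × OrderIso ρ w) )

module Submission where

-- Write σ = σ₁ m σ₂ with m its largest term, so that B(σ) = B(σ₁) σ₂ m, and follow an occurrence
-- of a λ b μ in B(σ) back into σ by induction on σ. The occurrence cannot end with the final m (the
-- last term of μ is below b), so it is a part in B(σ₁) followed by a part in σ₂. In σ all of σ₂
-- comes after m, which exceeds every other term: if b lies in σ₂, then m can play y (or x, when a
-- lies in σ₂ too); if b lies in B(σ₁) but no term of μ does, m can play z; otherwise the occurrence
-- of a λ b and part of μ lies in B(σ₁) and we recurse. The term x > a next to a comes from the same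
-- analysis applied to a and the terms of λ in B(σ₁). As y, z ≥ b exceed a, λ and μ, the occurrence
-- found in σ has the order type of π with z in the place of b, and standardizing it lands in R(π).

open import Defs
open import Data.Nat using (ℕ; zero; suc; _+_; _<_; _≤_; _<?_; _<ᵇ_; _≤?_; z≤n; s≤s)
import Data.Nat.Properties as Nat
open import Data.Nat.Properties
  using ( ≤-refl; ≤-trans; <-trans; <-irrefl; <-asym; <⇒≤; <-≤-trans; ≮⇒≥; ≰⇒>; ≤∧≢⇒<
        ; <-cmp; m≤n⇒m≤1+n; +-suc; +-identityʳ; suc-injective; <ᵇ-reflects-<)
open import Relation.Binary.PropositionalEquality as Eq
  using (_≡_; _≢_; refl; sym; trans; cong; cong₂; subst)
open import Data.Bool using (true; false)
open import Data.Empty using (⊥-elim)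
open import Data.Fin as Fin using (cast)
open import Data.List
  using (List; []; _∷_; _++_; [_]; length; lookup; map; zip; applyUpTo; initLast; _∷ʳ′_)
open import Data.List.Properties
  using (++-assoc; ++-identityʳ; ++-conicalʳ; ∷-injective; ∷ʳ-injective; length-++; length-map; map-applyUpTo)
open import Data.List.Membership.Propositional using (_∈_)
open import Data.List.Membership.Propositional.Properties using (∈-++⁺ʳ)
open import Data.List.Relation.Unary.All as All using (All; []; _∷_)
import Data.List.Relation.Unary.All.Properties as All
open import Data.List.Relation.Unary.AllPairs as AllPairs using (AllPairs; []; _∷_)
open import Data.List.Relation.Unary.Any using (here; there)
open import Data.List.Relation.Unary.Linked.Properties using (Linked⇒AllPairs)
open import Data.List.Relation.Unary.Unique.Propositional using (Unique)
open import Data.List.Relation.Binary.Permutation.Propositional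
  using (_↭_; ↭-refl; ↭-sym; ↭-trans; ↭-reflexive; ↭⇒↭ₛ)
open import Data.List.Relation.Binary.Permutation.Propositional.Properties
  using (All-resp-↭; ↭-length; ∷↭∷ʳ)
  renaming (++⁺ to ↭-++⁺)
open import Data.List.Relation.Binary.Permutation.Setoid.Properties (Eq.setoid ℕ)
  using (Unique-resp-↭)
open import Data.List.Relation.Binary.Sublist.Propositional
  using (_⊆_; []; _∷_; _∷ʳ_; ⊆-refl; ⊆-trans; minimum)
open import Data.List.Relation.Binary.Sublist.Propositional.Properties
  using (++⁺; ++⁺ˡ; ++⁺ʳ; All-resp-⊆)
open import Data.List.Sort Nat.≤-decTotalOrder using (sort; sort-↭; sort-↗)
open import Data.Product using (Σ-syntax; ∃₂; ∃-syntax; _×_; _,_; proj₁; proj₂)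
import Data.Product as Product
open import Data.Sum as Sum using (_⊎_; inj₁; inj₂)
open import Function using (_∘_)
open import Function.Bundles using (_⇔_; mk⇔; Equivalence)
open import Function.Properties.Equivalence using () renaming (sym to ⇔-sym)
open import Relation.Binary.Definitions using (tri<; tri≈; tri>)
open import Relation.Nullary using (yes; no)
open import Relation.Nullary.Reflects using (ofʸ; ofⁿ)

-- Lists and sublists

++-assoc₃ : ∀ (ws xs ys zs : List ℕ) → (ws ++ xs ++ ys) ++ zs ≡ ws ++ xs ++ ys ++ zs
++-assoc₃ ws xs ys zs = trans (++-assoc ws (xs ++ ys) zs) (cong (ws ++_) (++-assoc xs ys zs))

++-≡-++ : ∀ (xs ys : List ℕ) {zs ws} → xs ++ zs ≡ ys ++ ws →
  (∃[ ys′ ] (ys ≡ xs ++ ys′ × zs ≡ ys′ ++ ws)) ⊎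
  (∃₂ λ c xs′ → xs ≡ ys ++ c ∷ xs′ × ws ≡ c ∷ xs′ ++ zs)
++-≡-++ [] ys e = inj₁ (ys , refl , e)
++-≡-++ (x ∷ xs) [] refl = inj₂ (x , xs , refl , refl)
++-≡-++ (x ∷ xs) (y ∷ ys) e with ∷-injective e
... | refl , e′ with ++-≡-++ xs ys e′
...   | inj₁ (ys′ , refl , eq) = inj₁ (ys′ , refl , eq)
...   | inj₂ (c , xs′ , refl , eq) = inj₂ (c , xs′ , refl , eq)

++-∷≡∷ʳ⇒∈ : ∀ (xs : List ℕ) {b μ ys m} → xs ++ b ∷ μ ≡ ys ++ [ m ] → μ ≢ [] → b ∈ ys × m ∈ μ
++-∷≡∷ʳ⇒∈ xs {b} {μ} e μ≢[] with initLast μ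
... | [] = ⊥-elim (μ≢[] refl)
... | μ′ ∷ʳ′ d with ∷ʳ-injective (xs ++ b ∷ μ′) _ (trans (++-assoc xs (b ∷ μ′) [ d ]) e)
...   | refl , refl = ∈-++⁺ʳ xs (here refl) , ∈-++⁺ʳ μ′ (here refl)

Unique-resp-⊇ : ∀ {xs ys : List ℕ} → xs ⊆ ys → Unique ys → Unique xs
Unique-resp-⊇ [] u = u
Unique-resp-⊇ (y ∷ʳ p) (_ ∷ u) = Unique-resp-⊇ p u
Unique-resp-⊇ (refl ∷ p) (x∉ ∷ u) = All-resp-⊆ p x∉ ∷ Unique-resp-⊇ p u

⊆-++⁻ : ∀ ys {zs xs : List ℕ} → xs ⊆ ys ++ zs → ∃₂ λ u v → xs ≡ u ++ v × u ⊆ ys × v ⊆ zs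
⊆-++⁻ [] p = [] , _ , refl , [] , p
⊆-++⁻ (y ∷ ys) (.y ∷ʳ p) with ⊆-++⁻ ys p
... | u , v , e , pu , pv = u , v , e , y ∷ʳ pu , pv
⊆-++⁻ (y ∷ ys) (refl ∷ p) with ⊆-++⁻ ys p
... | u , v , refl , pu , pv = y ∷ u , v , refl , refl ∷ pu , pv

⊆-∷ʳ⁻ : ∀ ys {m} {xs : List ℕ} → xs ⊆ ys ++ [ m ] →
        xs ⊆ ys ⊎ ∃[ xs′ ] (xs ≡ xs′ ++ [ m ] × xs′ ⊆ ys)
⊆-∷ʳ⁻ ys p with ⊆-++⁻ ys p
... | u , _ , refl , pu , _ ∷ʳ [] = inj₁ (subst (_⊆ ys) (sym (++-identityʳ u)) pu)
... | u , _ , refl , pu , refl ∷ [] = inj₂ (u , refl , pu)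

⊆-dropMiddle : ∀ (ws xs : List ℕ) {y ys} → ws ++ xs ++ ys ⊆ ws ++ xs ++ y ∷ ys
⊆-dropMiddle ws xs {y} = ++⁺ (⊆-refl {x = ws}) (++⁺ (⊆-refl {x = xs}) (y ∷ʳ ⊆-refl))

data HeadSplit (a : ℕ) (ys zs l₁ l₂ : List ℕ) : Set where
  inLeft  : a ∷ l₁ ⊆ ys → l₂ ⊆ zs → HeadSplit a ys zs l₁ l₂
  inRight : l₁ ≡ [] → a ∷ l₂ ⊆ zs → HeadSplit a ys zs l₁ l₂

headSplit : ∀ ys {zs a xs} → a ∷ xs ⊆ ys ++ zs →
            ∃₂ λ l₁ l₂ → xs ≡ l₁ ++ l₂ × HeadSplit a ys zs l₁ l₂
headSplit ys p with ⊆-++⁻ ys p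
... | [] , _ , refl , _ , pv = [] , _ , refl , inRight refl pv
... | _ ∷ u , v , e , pu , pv with ∷-injective e
...   | refl , refl = u , v , refl , inLeft pu pv

HeadSplit-All : ∀ {P : ℕ → Set} {a ys zs l₁ l₂} →
                All P ys → All P zs → HeadSplit a ys zs l₁ l₂ → All P (a ∷ l₁ ++ l₂)
HeadSplit-All ys zs (inLeft pu pv) = All.++⁺ (All-resp-⊆ pu ys) (All-resp-⊆ pv zs)
HeadSplit-All ys zs (inRight refl p) = All-resp-⊆ p zs

HeadSplit-++⁻ : ∀ {a ys zs l₁ l₂} r → HeadSplit a ys zs l₁ (l₂ ++ r) → HeadSplit a ys zs l₁ l₂
HeadSplit-++⁻ r (inLeft pu pv) = inLeft pu (⊆-trans (++⁺ʳ r ⊆-refl) pv)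
HeadSplit-++⁻ r (inRight e p) = inRight e (⊆-trans (refl ∷ ++⁺ʳ r ⊆-refl) p)

HeadSplit-ends : ∀ {P : ℕ → Set} {a ys zs l₁ l₂ b μ} → All P ys → All P zs →
                 HeadSplit a ys zs l₁ (l₂ ++ b ∷ μ) → P a × P b
HeadSplit-ends {P} {a} {l₁ = l₁} {l₂} {b} {μ} ys zs hs =
  All.head all , All.lookup all (there (∈-++⁺ʳ l₁ (∈-++⁺ʳ l₂ (here refl))))
  where
  all : All P (a ∷ l₁ ++ l₂ ++ b ∷ μ)
  all = HeadSplit-All ys zs hs

-- Left to right maxima

lrMaxFrom-≡[] : ∀ c xs → lrMaxFrom c xs ≡ [] → All (_≤ c) xs
lrMaxFrom-≡[] c [] _ = []
lrMaxFrom-≡[] c (x ∷ xs) e with c <ᵇ x | <ᵇ-reflects-< c x | e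
... | false | ofⁿ c≮x | e′ = ≮⇒≥ c≮x ∷ lrMaxFrom-≡[] c xs e′
... | true  | ofʸ _   | ()

lrMaxFrom-head : ∀ c xs {y ys} → lrMaxFrom c xs ≡ y ∷ ys → c < y
lrMaxFrom-head c (x ∷ xs) e with c <ᵇ x | <ᵇ-reflects-< c x | e
... | false | ofⁿ _   | e′ = lrMaxFrom-head c xs e′
... | true  | ofʸ c<x | refl = c<x

lrMaxFrom-single : ∀ {c} lam {b μ} → All (_≢ b) lam → lrMaxFrom c (lam ++ b ∷ μ) ≡ [ b ] →
                 All (_≤ c) lam × c < b × All (_≤ b) μ
lrMaxFrom-single {c} [] {b} {μ} _ e with c <ᵇ b | <ᵇ-reflects-< c b | e
... | false | ofⁿ c≮b | e′ = ⊥-elim (c≮b (lrMaxFrom-head c μ e′))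
... | true  | ofʸ c<b | e′ = [] , c<b , lrMaxFrom-≡[] b μ (proj₂ (∷-injective e′))
lrMaxFrom-single {c} (l ∷ lam) (l≢b ∷ lam≢b) e with c <ᵇ l | <ᵇ-reflects-< c l | e
... | true  | ofʸ _   | e′ = ⊥-elim (l≢b (proj₁ (∷-injective e′)))
... | false | ofⁿ c≮l | e′ = Product.map₁ (≮⇒≥ c≮l ∷_) (lrMaxFrom-single lam lam≢b e′)

Unique-middle : ∀ (lam : List ℕ) {b μ} → Unique (lam ++ b ∷ μ) → All (_≢ b) lam × All (b ≢_) μ
Unique-middle [] (b∉μ ∷ _) = [] , b∉μ
Unique-middle (l ∷ lam) (l∉ ∷ u) =
  Product.map₁ (All.lookup l∉ (∈-++⁺ʳ lam (here refl)) ∷_) (Unique-middle lam u)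

two-lrMaxima : ∀ {a lam b μ} → Unique (a ∷ lam ++ b ∷ μ) →
               lrMaxima (a ∷ lam ++ b ∷ μ) ≡ a ∷ b ∷ [] →
               All (_< a) lam × a < b × All (_< b) μ
two-lrMaxima {a} {lam} (a∉ ∷ u) e
  with lam≢b , b∉μ ← Unique-middle lam u
  with lam≤a , a<b , μ≤b ← lrMaxFrom-single lam lam≢b (proj₂ (∷-injective e))
  = All.zipWith (λ (l≤a , a≢l) → ≤∧≢⇒< l≤a (a≢l ∘ sym)) (lam≤a , All.++⁻ˡ lam a∉) ,
    a<b ,
    All.zipWith (λ (m≤b , b≢m) → ≤∧≢⇒< m≤b (b≢m ∘ sym)) (μ≤b , b∉μ)

-- The operator B

BRel⇒↭ : ∀ {s t} → BRel s t → s ↭ t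
BRel⇒↭ B-nil = ↭-refl
BRel⇒↭ (B-cons _ _ r) = ↭-++⁺ (BRel⇒↭ r) (∷↭∷ʳ _ _)

B-step-below : ∀ {s₁ s₂ t m} → All (_< m) s₁ → All (_< m) s₂ → BRel s₁ t → All (_< m) (t ++ s₂)
B-step-below h₁ h₂ r = All.++⁺ (All-resp-↭ (BRel⇒↭ r) h₁) h₂

-- How an occurrence of a λ b μ in B(s₁ m s₂) = B(s₁) s₂ m splits, according to where b lies.
data StepView (t s₂ : List ℕ) (m a : ℕ) (lam : List ℕ) (b : ℕ) (μ : List ℕ) : Set where
  endsWithMax  : ∀ xs → a ∷ lam ++ b ∷ μ ≡ xs ++ [ m ] → xs ⊆ t ++ s₂ → StepView t s₂ m a lam b μ
  splitBeforeB : ∀ l₁ l₂ → lam ≡ l₁ ++ l₂ → HeadSplit a t s₂ l₁ (l₂ ++ b ∷ μ) →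
                 StepView t s₂ m a lam b μ
  splitAfterB  : ∀ μ₁ μ₂ → μ ≡ μ₁ ++ μ₂ → a ∷ lam ++ b ∷ μ₁ ⊆ t → μ₂ ⊆ s₂ →
                 StepView t s₂ m a lam b μ

stepView : ∀ t s₂ {m a lam b μ} → a ∷ lam ++ b ∷ μ ⊆ t ++ s₂ ++ [ m ] → StepView t s₂ m a lam b μ
stepView t s₂ {m} {lam = lam} p with ⊆-∷ʳ⁻ (t ++ s₂) (subst (_ ⊆_) (sym (++-assoc t s₂ [ m ])) p)
... | inj₂ (xs , e , q) = endsWithMax xs e q
... | inj₁ q with headSplit t q
...   | l₁ , l₂ , e , hs with ++-≡-++ l₁ lam (sym e)
...     | inj₁ (l₂′ , refl , refl) = splitBeforeB l₁ l₂′ refl hs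
...     | inj₂ (_ , μ₁ , refl , eq) with ∷-injective eq | hs
...       | refl , refl | inLeft pu pv = splitAfterB μ₁ l₂ refl pu pv
...       | refl , refl | inRight e′ _ with () ← ++-conicalʳ lam _ e′

-- The condition on aFirst mirrors the clause of R(π) forcing x = y when a precedes x and λ₁ is empty.
data Flanked (a : ℕ) (L s : List ℕ) : Set where
  flanked : ∀ f x → a < x → (f ≡ aFirst → L ≢ []) → front f a x ++ L ⊆ s → Flanked a L s
  alone   : L ≡ [] → [ a ] ⊆ s → Flanked a L s

flanked-by : ∀ f {a x L s} → a < x → front f a x ++ L ⊆ s → Flanked a L s
flanked-by xFirst a<x p = flanked xFirst _ a<x (λ ()) p
flanked-by aFirst {L = []} _ p = alone refl (⊆-trans (refl ∷ _ ∷ʳ []) p)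
flanked-by aFirst {L = _ ∷ _} a<x p = flanked aFirst _ a<x (λ _ ()) p

-- The trace in s₁ m s₂ of a l₁ in B(s₁) followed by l₂ in s₂: m separates l₁ from l₂, or plays x.
data ThroughMax (a : ℕ) (l₁ l₂ : List ℕ) (m : ℕ) (s : List ℕ) : Set where
  belowMax : ∀ f x → a < x → x < m → (f ≡ aFirst → l₁ ≢ []) → front f a x ++ l₁ ++ m ∷ l₂ ⊆ s →
             ThroughMax a l₁ l₂ m s
  byMax    : ∀ f → front f a m ++ l₁ ++ l₂ ⊆ s → ThroughMax a l₁ l₂ m s

ThroughMax⇒Flanked : ∀ {a l₁ l₂ m s} → a < m → ThroughMax a l₁ l₂ m s → Flanked a (l₁ ++ l₂) s
ThroughMax⇒Flanked {a} {l₁} _ (belowMax f x a<x _ _ p) =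
  flanked-by f a<x (⊆-trans (⊆-dropMiddle (front f a x) l₁) p)
ThroughMax⇒Flanked a<m (byMax f p) = flanked-by f a<m p

All-front-x : ∀ f {P : ℕ → Set} {a x L} → All P (front f a x ++ L) → P x
All-front-x aFirst (_ ∷ px ∷ _) = px
All-front-x xFirst (px ∷ _) = px

mutual
  flanked-B : ∀ {s t a L} → BRel s t → a ∷ L ⊆ t → All (_≤ a) L → Flanked a L s
  flanked-B B-nil ()
  flanked-B (B-cons {s₁} {s₂} {t} {m} h₁ h₂ r) p L≤a
    with ⊆-∷ʳ⁻ (t ++ s₂) (subst (_ ⊆_) (sym (++-assoc t s₂ [ m ])) p)
  ... | inj₂ ([] , refl , _) = alone refl (++⁺ˡ s₁ (refl ∷ minimum _))
  ... | inj₂ (_ ∷ xs , refl , q) =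
    ⊥-elim (Nat.<⇒≱ (All.head (All-resp-⊆ q (B-step-below h₁ h₂ r)))
                     (All.lookup L≤a (∈-++⁺ʳ xs (here refl))))
  ... | inj₁ q with headSplit t q
  ...   | l₁ , _ , refl , hs =
    ThroughMax⇒Flanked (All.head (All-resp-⊆ q (B-step-below h₁ h₂ r)))
      (through-max h₁ r (All.++⁻ˡ l₁ L≤a) hs)

  through-max : ∀ {s₁ s₂ t m a l₁ l₂} → All (_< m) s₁ → BRel s₁ t → All (_≤ a) l₁ →
                HeadSplit a t s₂ l₁ l₂ → ThroughMax a l₁ l₂ m (s₁ ++ m ∷ s₂)
  through-max {s₁} _ _ _ (inRight refl p) = byMax xFirst (++⁺ˡ s₁ (refl ∷ p))
  through-max {m = m} {l₁ = l₁} {l₂} h₁ r l₁≤a (inLeft pu pv) with flanked-B r pu l₁≤a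
  ... | flanked f x a<x c p =
    belowMax f x a<x (All-front-x f (All-resp-⊆ p h₁)) c
      (subst (_⊆ _) (++-assoc (front f _ x) l₁ (m ∷ l₂)) (++⁺ p (refl ∷ pv)))
  ... | alone refl p = byMax aFirst (++⁺ p (refl ∷ pv))

-- What an occurrence of a λ b in B(s) leaves in s: b itself is replaced by some y ≥ b.
data Prefix (a : ℕ) (lam : List ℕ) (b : ℕ) (s : List ℕ) : Set where
  distinct : ∀ f x l₁ y l₂ → l₁ ++ l₂ ≡ lam → a < x → x < y → b ≤ y → (f ≡ aFirst → l₁ ≢ []) →
             front f a x ++ l₁ ++ y ∷ l₂ ⊆ s → Prefix a lam b s
  same     : ∀ f x → a < x → b ≤ x → front f a x ++ lam ⊆ s → Prefix a lam b s

Prefix-resp-⊆ : ∀ {a lam b s s′} → s ⊆ s′ → Prefix a lam b s → Prefix a lam b s′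
Prefix-resp-⊆ q (distinct f x l₁ y l₂ e a<x x<y b≤y c p) =
  distinct f x l₁ y l₂ e a<x x<y b≤y c (⊆-trans p q)
Prefix-resp-⊆ q (same f x a<x b≤x p) = same f x a<x b≤x (⊆-trans p q)

ThroughMax⇒Prefix : ∀ {a l₁ l₂ m b s} → a < m → b ≤ m → ThroughMax a l₁ l₂ m s →
                    Prefix a (l₁ ++ l₂) b s
ThroughMax⇒Prefix _ b≤m (belowMax f x a<x x<m c p) = distinct f x _ _ _ refl a<x x<m b≤m c p
ThroughMax⇒Prefix a<m b≤m (byMax f p) = same f _ a<m b≤m p

prefix-B : ∀ {s t a lam b} → BRel s t → a ∷ lam ++ [ b ] ⊆ t → All (_≤ a) lam → Prefix a lam b s
prefix-B B-nil ()
prefix-B {a = a} {lam} {b} (B-cons {s₁} {s₂} {t} {m} h₁ h₂ r) p lam≤a with stepView t s₂ p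
... | endsWithMax xs e q
  with refl , refl ← ∷ʳ-injective (a ∷ lam) xs e
  with l₁ , _ , refl , hs ← headSplit t q
  = ThroughMax⇒Prefix (All.head (All-resp-⊆ q (B-step-below h₁ h₂ r))) ≤-refl
      (through-max h₁ r (All.++⁻ˡ l₁ lam≤a) hs)
... | splitBeforeB l₁ _ refl hs
  with a<m , b<m ← HeadSplit-ends (All-resp-↭ (BRel⇒↭ r) h₁) h₂ hs
  = ThroughMax⇒Prefix a<m (<⇒≤ b<m) (through-max h₁ r (All.++⁻ˡ l₁ lam≤a) (HeadSplit-++⁻ [ b ] hs))
... | splitAfterB [] _ _ q _ = Prefix-resp-⊆ (++⁺ʳ (m ∷ s₂) ⊆-refl) (prefix-B r q lam≤a)

-- The two shapes of RShape before standardization, with z standing in for b.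
data Pattern (a : ℕ) (lam : List ℕ) (b : ℕ) (μ s : List ℕ) : Set where
  distinct : ∀ f x l₁ y l₂ z → l₁ ++ l₂ ≡ lam → a < x → x < y → x < z → b ≤ y → b ≤ z →
             (f ≡ aFirst → l₁ ≢ []) → front f a x ++ l₁ ++ y ∷ l₂ ++ z ∷ μ ⊆ s →
             Pattern a lam b μ s
  same     : ∀ f x z → a < x → b ≤ x → b ≤ z → front f a x ++ lam ++ z ∷ μ ⊆ s →
             Pattern a lam b μ s

Prefix⇒Pattern : ∀ {a lam b s₁ m s₂ v} → All (_< m) s₁ → b ≤ m → v ⊆ s₂ →
                 Prefix a lam b s₁ → Pattern a lam b v (s₁ ++ m ∷ s₂)
Prefix⇒Pattern {m = m} {v = v} h₁ b≤m pv (distinct f x l₁ y l₂ e a<x x<y b≤y c p) =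
  distinct f x l₁ y l₂ m e a<x x<y (All-front-x f (All-resp-⊆ p h₁)) b≤y b≤m c
    (subst (_⊆ _) (++-assoc₃ (front f _ x) l₁ (y ∷ l₂) (m ∷ v)) (++⁺ p (refl ∷ pv)))
Prefix⇒Pattern {lam = lam} {m = m} {v = v} _ b≤m pv (same f x a<x b≤x p) =
  same f x m a<x b≤x b≤m (subst (_⊆ _) (++-assoc (front f _ x) lam (m ∷ v)) (++⁺ p (refl ∷ pv)))

Pattern-++ : ∀ {a lam b μ s₁ m s₂ v} → v ⊆ s₂ → Pattern a lam b μ s₁ →
             Pattern a lam b (μ ++ v) (s₁ ++ m ∷ s₂)
Pattern-++ {μ = μ} {m = m} {v = v} pv (distinct f x l₁ y l₂ z e a<x x<y x<z b≤y b≤z c p) =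
  distinct f x l₁ y l₂ z e a<x x<y x<z b≤y b≤z c (subst (_⊆ _) reassoc (++⁺ p (m ∷ʳ pv)))
  where
  reassoc : (front f _ x ++ l₁ ++ y ∷ l₂ ++ z ∷ μ) ++ v ≡ front f _ x ++ l₁ ++ y ∷ l₂ ++ z ∷ μ ++ v
  reassoc = trans (++-assoc₃ (front f _ x) l₁ (y ∷ l₂ ++ z ∷ μ) v)
                  (cong (λ r → front f _ x ++ l₁ ++ y ∷ r) (++-assoc l₂ (z ∷ μ) v))
Pattern-++ {lam = lam} {μ = μ} {m = m} {v = v} pv (same f x z a<x b≤x b≤z p) =
  same f x z a<x b≤x b≤z (subst (_⊆ _) (++-assoc₃ (front f _ x) lam (z ∷ μ) v) (++⁺ p (m ∷ʳ pv)))

ThroughMax⇒Pattern : ∀ {a l₁ l₂ m b μ s} → a < m → b ≤ m → ThroughMax a l₁ (l₂ ++ b ∷ μ) m s →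
                     Pattern a (l₁ ++ l₂) b μ s
ThroughMax⇒Pattern {a} {l₁} {l₂} {b = b} {μ} _ b≤m (belowMax f x a<x x<m c p) with b ≤? x
... | yes b≤x = same f x b a<x b≤x ≤-refl
                  (subst (_⊆ _) (cong (front f a x ++_) (sym (++-assoc l₁ l₂ (b ∷ μ))))
                         (⊆-trans (⊆-dropMiddle (front f a x) l₁) p))
... | no b≰x = distinct f x l₁ _ l₂ b refl a<x x<m (≰⇒> b≰x) b≤m ≤-refl c p
ThroughMax⇒Pattern {a} {l₁} {l₂} {m} {b} {μ} a<m b≤m (byMax f p) =
  same f m b a<m b≤m ≤-refl (subst (_⊆ _) (cong (front f a m ++_) (sym (++-assoc l₁ l₂ (b ∷ μ)))) p)

pattern-B : ∀ {s t a lam b μ} → BRel s t → a ∷ lam ++ b ∷ μ ⊆ t →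
            All (_≤ a) lam → All (_< b) μ → μ ≢ [] → Pattern a lam b μ s
pattern-B B-nil ()
pattern-B {a = a} {lam} {b} (B-cons {s₁} {s₂} {t} {m} h₁ h₂ r) p lam≤a μ<b μ≢[] with stepView t s₂ p
... | endsWithMax xs e q
  with b∈xs , m∈μ ← ++-∷≡∷ʳ⇒∈ (a ∷ lam) e μ≢[]
  = ⊥-elim (<-asym (All.lookup (All-resp-⊆ q (B-step-below h₁ h₂ r)) b∈xs) (All.lookup μ<b m∈μ))
... | splitBeforeB l₁ _ refl hs
  with a<m , b<m ← HeadSplit-ends (All-resp-↭ (BRel⇒↭ r) h₁) h₂ hs
  = ThroughMax⇒Pattern a<m (<⇒≤ b<m) (through-max h₁ r (All.++⁻ˡ l₁ lam≤a) hs)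
... | splitAfterB [] _ refl q pv =
  Prefix⇒Pattern h₁ (<⇒≤ b<m) pv (prefix-B r q lam≤a)
  where
  b<m : b < m
  b<m = All.lookup (All-resp-⊆ q (All-resp-↭ (BRel⇒↭ r) h₁)) (there (∈-++⁺ʳ lam (here refl)))
... | splitAfterB μ₁@(_ ∷ _) _ refl q pv = Pattern-++ pv (pattern-B r q lam≤a (All.++⁻ˡ μ₁ μ<b) (λ ()))

-- Order isomorphism

Concordant : ℕ × ℕ → ℕ × ℕ → Set
Concordant p q = (proj₁ p < proj₁ q) ⇔ (proj₂ p < proj₂ q)

-- OrderIso restated through the pairs of corresponding terms, which avoids positional bookkeeping.
OrderIso′ : List ℕ → List ℕ → Set
OrderIso′ xs ys = length xs ≡ length ys × (∀ {p q} → p ∈ zip xs ys → q ∈ zip xs ys → Concordant p q)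

∈-zip⇒lookup : ∀ (xs ys : List ℕ) (e : length xs ≡ length ys) {p} → p ∈ zip xs ys →
               ∃[ i ] p ≡ (lookup xs i , lookup ys (cast e i))
∈-zip⇒lookup (x ∷ xs) (y ∷ ys) e (here refl) = Fin.zero , refl
∈-zip⇒lookup (x ∷ xs) (y ∷ ys) e (there p∈) with ∈-zip⇒lookup xs ys (suc-injective e) p∈
... | i , refl = Fin.suc i , refl

lookup-∈-zip : ∀ (xs ys : List ℕ) (e : length xs ≡ length ys) i →
               (lookup xs i , lookup ys (cast e i)) ∈ zip xs ys
lookup-∈-zip (x ∷ xs) (y ∷ ys) e Fin.zero = here refl
lookup-∈-zip (x ∷ xs) (y ∷ ys) e (Fin.suc i) = there (lookup-∈-zip xs ys (suc-injective e) i)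

OrderIso⇒OrderIso′ : ∀ {xs ys} → OrderIso xs ys → OrderIso′ xs ys
OrderIso⇒OrderIso′ {xs} {ys} (e , iso) =
  e , λ p∈ q∈ → concordant (∈-zip⇒lookup xs ys e p∈) (∈-zip⇒lookup xs ys e q∈)
  where
  concordant : ∀ {p q} → ∃[ i ] p ≡ (lookup xs i , lookup ys (cast e i)) →
               ∃[ j ] q ≡ (lookup xs j , lookup ys (cast e j)) → Concordant p q
  concordant (i , refl) (j , refl) = iso i j

OrderIso′⇒OrderIso : ∀ {xs ys} → OrderIso′ xs ys → OrderIso xs ys
OrderIso′⇒OrderIso {xs} {ys} (e , con) = e , λ i j → con (lookup-∈-zip xs ys e i) (lookup-∈-zip xs ys e j)

∈-zip-swap : ∀ (xs ys : List ℕ) {p} → p ∈ zip ys xs → Product.swap p ∈ zip xs ys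
∈-zip-swap (x ∷ xs) (y ∷ ys) (here refl) = here refl
∈-zip-swap (x ∷ xs) (y ∷ ys) (there p∈) = there (∈-zip-swap xs ys p∈)

OrderIso′-sym : ∀ {xs ys} → OrderIso′ xs ys → OrderIso′ ys xs
OrderIso′-sym {xs} {ys} (e , con) =
  sym e , λ p∈ q∈ → ⇔-sym (con (∈-zip-swap xs ys p∈) (∈-zip-swap xs ys q∈))

∈-zip-map : ∀ (g : ℕ → ℕ) w {p} → p ∈ zip w (map g w) → ∃[ u ] (u ∈ w × p ≡ (u , g u))
∈-zip-map g (u ∷ w) (here refl) = u , here refl , refl
∈-zip-map g (u ∷ w) (there p∈) = Product.map₂ (Product.map₁ there) (∈-zip-map g w p∈)

OrderIso′-map : ∀ (g : ℕ → ℕ) w → (∀ {u v} → u ∈ w → v ∈ w → (u < v ⇔ g u < g v)) →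
                OrderIso′ w (map g w)
OrderIso′-map g w mono =
  sym (length-map g w) , λ p∈ q∈ → concordant (∈-zip-map g w p∈) (∈-zip-map g w q∈)
  where
  concordant : ∀ {p q} → ∃[ u ] (u ∈ w × p ≡ (u , g u)) → ∃[ v ] (v ∈ w × q ≡ (v , g v)) → Concordant p q
  concordant (u , u∈ , refl) (v , v∈ , refl) = mono u∈ v∈

All-zip : ∀ {P Q : ℕ → Set} {xs ys p} → All P xs → All Q ys → p ∈ zip xs ys → P (proj₁ p) × Q (proj₂ p)
All-zip (px ∷ _) (qy ∷ _) (here refl) = px , qy
All-zip (_ ∷ pxs) (_ ∷ qys) (there p∈) = All-zip pxs qys p∈

length-++-≡ : ∀ (xs xs′ : List ℕ) {ys ys′ : List ℕ} → length xs ≡ length xs′ → length ys ≡ length ys′ →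
              length (xs ++ ys) ≡ length (xs′ ++ ys′)
length-++-≡ xs xs′ e e′ = trans (length-++ xs) (trans (cong₂ _+_ e e′) (sym (length-++ xs′)))

∈-zip-++⁺ˡ : ∀ (xs xs′ : List ℕ) {ys ys′ p} → length xs ≡ length xs′ → p ∈ zip xs xs′ →
             p ∈ zip (xs ++ ys) (xs′ ++ ys′)
∈-zip-++⁺ˡ (x ∷ xs) (x′ ∷ xs′) _ (here refl) = here refl
∈-zip-++⁺ˡ (x ∷ xs) (x′ ∷ xs′) e (there p∈) = there (∈-zip-++⁺ˡ xs xs′ (suc-injective e) p∈)

module _ {ys ys′ : List ℕ} {z n : ℕ} where

  ∈-zip-inserted : ∀ (xs xs′ : List ℕ) → length xs ≡ length xs′ →
                   (z , n) ∈ zip (xs ++ z ∷ ys) (xs′ ++ n ∷ ys′)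
  ∈-zip-inserted [] [] _ = here refl
  ∈-zip-inserted (x ∷ xs) (x′ ∷ xs′) e = there (∈-zip-inserted xs xs′ (suc-injective e))

  ∈-zip-insert⁺ : ∀ (xs xs′ : List ℕ) {p} → length xs ≡ length xs′ →
                  p ∈ zip (xs ++ ys) (xs′ ++ ys′) → p ∈ zip (xs ++ z ∷ ys) (xs′ ++ n ∷ ys′)
  ∈-zip-insert⁺ [] [] _ p∈ = there p∈
  ∈-zip-insert⁺ (x ∷ xs) (x′ ∷ xs′) _ (here refl) = here refl
  ∈-zip-insert⁺ (x ∷ xs) (x′ ∷ xs′) e (there p∈) = there (∈-zip-insert⁺ xs xs′ (suc-injective e) p∈)

  ∈-zip-insert⁻ : ∀ (xs xs′ : List ℕ) {p} → length xs ≡ length xs′ →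
                  p ∈ zip (xs ++ z ∷ ys) (xs′ ++ n ∷ ys′) → p ≡ (z , n) ⊎ p ∈ zip (xs ++ ys) (xs′ ++ ys′)
  ∈-zip-insert⁻ [] [] _ (here refl) = inj₁ refl
  ∈-zip-insert⁻ [] [] _ (there p∈) = inj₂ p∈
  ∈-zip-insert⁻ (x ∷ xs) (x′ ∷ xs′) _ (here refl) = inj₂ (here refl)
  ∈-zip-insert⁻ (x ∷ xs) (x′ ∷ xs′) e (there p∈) =
    Sum.map₂ there (∈-zip-insert⁻ xs xs′ (suc-injective e) p∈)

OrderIso′-below : ∀ {xs ys c c′} → OrderIso′ xs ys → (c , c′) ∈ zip xs ys →
                  ∀ us us′ → length us ≡ length us′ → (∀ {p} → p ∈ zip us us′ → p ∈ zip xs ys) →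
                  All (_< c) us → All (_< c′) us′
OrderIso′-below _ _ [] [] _ _ [] = []
OrderIso′-below iso c∈ (u ∷ us) (u′ ∷ us′) e sub (u<c ∷ us<c) =
  Equivalence.to (proj₂ iso (sub (here refl)) c∈) u<c ∷
  OrderIso′-below iso c∈ us us′ (suc-injective e) (sub ∘ there) us<c

module _ (xs xs′ : List ℕ) {ys ys′ : List ℕ} {b n : ℕ}
         (iso : OrderIso′ (xs ++ b ∷ ys) (xs′ ++ n ∷ ys′))
         (e : length xs ≡ length xs′) (e′ : length ys ≡ length ys′)
         (below : All (_< b) (xs ++ ys)) where

  OrderIso′-max : All (_< n) (xs′ ++ ys′)
  OrderIso′-max = OrderIso′-below iso (∈-zip-inserted xs xs′ e) (xs ++ ys) (xs′ ++ ys′)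
                    (length-++-≡ xs xs′ e e′) (∈-zip-insert⁺ xs xs′ e) below

  OrderIso′-raise : ∀ {z} → b ≤ z → OrderIso′ (xs ++ z ∷ ys) (xs′ ++ n ∷ ys′)
  OrderIso′-raise {z} b≤z =
    length-++-≡ xs xs′ e (cong suc e′) , λ p∈ q∈ → compare (classify p∈) (classify q∈)
    where
    Old : ℕ × ℕ → Set
    Old p = p ∈ zip (xs ++ b ∷ ys) (xs′ ++ n ∷ ys′) × proj₁ p < b × proj₂ p < n

    classify : ∀ {p} → p ∈ zip (xs ++ z ∷ ys) (xs′ ++ n ∷ ys′) → p ≡ (z , n) ⊎ Old p
    classify p∈ with ∈-zip-insert⁻ xs xs′ e p∈
    ... | inj₁ refl = inj₁ refl
    ... | inj₂ p∈′ = inj₂ (∈-zip-insert⁺ xs xs′ e p∈′ , All-zip below OrderIso′-max p∈′)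

    compare : ∀ {p q} → p ≡ (z , n) ⊎ Old p → q ≡ (z , n) ⊎ Old q → Concordant p q
    compare (inj₂ (p∈ , _)) (inj₂ (q∈ , _)) = proj₂ iso p∈ q∈
    compare (inj₂ (_ , p<b , p<n)) (inj₁ refl) = mk⇔ (λ _ → p<n) (λ _ → <-≤-trans p<b b≤z)
    compare (inj₁ refl) (inj₂ (_ , q<b , q<n)) =
      mk⇔ (λ z<q → ⊥-elim (<-asym z<q (<-≤-trans q<b b≤z))) (λ n<q → ⊥-elim (<-asym n<q q<n))
    compare (inj₁ refl) (inj₁ refl) =
      mk⇔ (λ z<z → ⊥-elim (<-irrefl refl z<z)) (λ n<n → ⊥-elim (<-irrefl refl n<n))

-- Standardization

countBelow : ℕ → List ℕ → ℕ
countBelow v [] = 0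
countBelow v (u ∷ us) with u <? v
... | yes _ = suc (countBelow v us)
... | no _ = countBelow v us

countBelow-≤-length : ∀ v w → countBelow v w ≤ length w
countBelow-≤-length v [] = z≤n
countBelow-≤-length v (u ∷ us) with u <? v
... | yes _ = s≤s (countBelow-≤-length v us)
... | no _ = m≤n⇒m≤1+n (countBelow-≤-length v us)

countBelow-mono : ∀ {v v′} w → v ≤ v′ → countBelow v w ≤ countBelow v′ w
countBelow-mono [] _ = z≤n
countBelow-mono {v} {v′} (u ∷ us) v≤v′ with u <? v | u <? v′
... | yes _   | yes _    = s≤s (countBelow-mono us v≤v′)
... | yes u<v | no u≮v′ = ⊥-elim (u≮v′ (<-≤-trans u<v v≤v′))
... | no _    | yes _    = m≤n⇒m≤1+n (countBelow-mono us v≤v′)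
... | no _    | no _     = countBelow-mono us v≤v′

countBelow-strict : ∀ {v v′} w → v < v′ → v ∈ w → countBelow v w < countBelow v′ w
countBelow-strict {v} {v′} (u ∷ us) v<v′ (here refl) with u <? v | u <? v′
... | yes u<u | _       = ⊥-elim (<-irrefl refl u<u)
... | no _    | yes _   = s≤s (countBelow-mono us (<⇒≤ v<v′))
... | no _    | no u≮v′ = ⊥-elim (u≮v′ v<v′)
countBelow-strict {v} {v′} (u ∷ us) v<v′ (there v∈) with u <? v | u <? v′
... | yes _   | yes _    = s≤s (countBelow-strict us v<v′ v∈)
... | yes u<v | no u≮v′ = ⊥-elim (u≮v′ (<-trans u<v v<v′))
... | no _    | yes _    = m≤n⇒m≤1+n (countBelow-strict us v<v′ v∈)
... | no _    | no _     = countBelow-strict us v<v′ v∈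

countBelow-< : ∀ {v} w → v ∈ w → countBelow v w < length w
countBelow-< {v} (u ∷ us) (here refl) with u <? v
... | yes u<u = ⊥-elim (<-irrefl refl u<u)
... | no _ = s≤s (countBelow-≤-length v us)
countBelow-< {v} (u ∷ us) (there v∈) with u <? v
... | yes _ = s≤s (countBelow-< us v∈)
... | no _ = m≤n⇒m≤1+n (countBelow-< us v∈)

rank : List ℕ → ℕ → ℕ
rank w v = suc (countBelow v w)

rank-<⇔ : ∀ w {u v} → u ∈ w → v ∈ w → (u < v ⇔ rank w u < rank w v)
rank-<⇔ w {u} {v} u∈ v∈ = mk⇔ (λ u<v → s≤s (countBelow-strict w u<v u∈)) from
  where
  from : rank w u < rank w v → u < v
  from r<r with <-cmp u v
  ... | tri< u<v _ _ = u<v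
  ... | tri≈ _ refl _ = ⊥-elim (<-irrefl refl r<r)
  ... | tri> _ _ v<u = ⊥-elim (<-asym r<r (s≤s (countBelow-strict w v<u v∈)))

rank-injective : ∀ w {u v} → u ∈ w → v ∈ w → rank w u ≡ rank w v → u ≡ v
rank-injective w {u} {v} u∈ v∈ r≡r with <-cmp u v
... | tri< u<v _ _ = ⊥-elim (<-irrefl r≡r (Equivalence.to (rank-<⇔ w u∈ v∈) u<v))
... | tri≈ _ u≡v _ = u≡v
... | tri> _ _ v<u = ⊥-elim (<-irrefl (sym r≡r) (Equivalence.to (rank-<⇔ w v∈ u∈) v<u))

standardize : List ℕ → List ℕ
standardize w = map (rank w) w

standardize-OrderIso′ : ∀ w → OrderIso′ w (standardize w)
standardize-OrderIso′ w = OrderIso′-map (rank w) w (rank-<⇔ w)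

Unique-map⁺ : ∀ (g : ℕ → ℕ) {xs} → (∀ {u v} → u ∈ xs → v ∈ xs → g u ≡ g v → u ≡ v) →
              Unique xs → Unique (map g xs)
Unique-map⁺ g inj [] = []
Unique-map⁺ g inj (x∉ ∷ u) =
  All.map⁺ (All.tabulate λ y∈ gx≡gy → All.lookup x∉ y∈ (inj (here refl) (there y∈) gx≡gy))
  ∷ Unique-map⁺ g (λ u∈ v∈ → inj (there u∈) (there v∈)) u

applyUpTo-cong : ∀ {f g : ℕ → ℕ} → (∀ i → f i ≡ g i) → ∀ n → applyUpTo f n ≡ applyUpTo g n
applyUpTo-cong f≗g zero = refl
applyUpTo-cong f≗g (suc n) = cong₂ _∷_ (f≗g 0) (applyUpTo-cong (f≗g ∘ suc) n)

AllPairs<-bounded : ∀ lo {xs} → AllPairs _<_ xs → All (lo ≤_) xs → All (_< lo + length xs) xs →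
                    xs ≡ applyUpTo (lo +_) (length xs)
AllPairs<-bounded lo [] [] [] = refl
AllPairs<-bounded lo {x ∷ xs} (x<xs ∷ increasing) (lo≤x ∷ _) (x<top ∷ xs<top) =
  cong₂ _∷_ (Nat.≤-antisym (x≤lo+0 xs x<xs rest x<top) (subst (_≤ x) (sym (+-identityʳ lo)) lo≤x))
            (trans rest (sym (applyUpTo-cong (+-suc lo) (length xs))))
  where
  rest : xs ≡ applyUpTo (suc lo +_) (length xs)
  rest = AllPairs<-bounded (suc lo) increasing (All.map (≤-trans (s≤s lo≤x)) x<xs)
           (All.map (λ {y} → subst (y <_) (+-suc lo (length xs))) xs<top)
  x≤lo+0 : ∀ ys → All (x <_) ys → ys ≡ applyUpTo (suc lo +_) (length ys) →
           x < lo + suc (length ys) → x ≤ lo + 0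
  x≤lo+0 [] _ _ x<top = Nat.≤-pred (subst (x <_) (+-suc lo 0) x<top)
  x≤lo+0 (_ ∷ _) (x<y ∷ _) y∷ys≡ _ = Nat.≤-pred (subst (x <_) (proj₁ (∷-injective y∷ys≡)) x<y)

Unique-bounded⇒IsPerm : ∀ {ρ} → Unique ρ → All (λ r → 0 < r × r ≤ length ρ) ρ → IsPerm ρ
Unique-bounded⇒IsPerm {ρ} uρ bounds =
  ↭-trans (↭-sym (sort-↭ ρ))
          (↭-reflexive (trans sorted≡ (sym (map-applyUpTo (λ i → i) suc (length ρ)))))
  where
  |sort| : length (sort ρ) ≡ length ρ
  |sort| = ↭-length (sort-↭ ρ)
  increasing : AllPairs _<_ (sort ρ)
  increasing = AllPairs.zipWith (λ (x≤y , x≢y) → ≤∧≢⇒< x≤y x≢y)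
                 (Linked⇒AllPairs ≤-trans (sort-↗ ρ) , Unique-resp-↭ (↭⇒↭ₛ (↭-sym (sort-↭ ρ))) uρ)
  bounds′ : All (λ r → 0 < r × r ≤ length ρ) (sort ρ)
  bounds′ = All-resp-↭ (↭-sym (sort-↭ ρ)) bounds
  sorted≡ : sort ρ ≡ applyUpTo suc (length ρ)
  sorted≡ = trans (AllPairs<-bounded 1 increasing (All.map proj₁ bounds′)
                     (All.map (λ (_ , r≤) → s≤s (subst (_ ≤_) (sym |sort|) r≤)) bounds′))
                  (cong (applyUpTo suc) |sort|)

standardize-IsPerm : ∀ w → Unique w → IsPerm (standardize w)
standardize-IsPerm w uw = Unique-bounded⇒IsPerm (Unique-map⁺ (rank w) (rank-injective w) uw)
  (All.map⁺ (All.tabulate λ {v} v∈ →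
    s≤s z≤n , subst (rank w v ≤_) (sym (length-map (rank w) w)) (countBelow-< w v∈)))

-- Assembling a member of R(π)

++-length⁻ : ∀ (xs : List ℕ) {ys} (zs : List ℕ) → length zs ≡ length (xs ++ ys) →
             ∃₂ λ zs₁ zs₂ → zs ≡ zs₁ ++ zs₂ × length xs ≡ length zs₁ × length ys ≡ length zs₂
++-length⁻ [] zs e = [] , zs , refl , refl , sym e
++-length⁻ (x ∷ xs) {ys} (z ∷ zs) e with ++-length⁻ xs {ys} zs (suc-injective e)
... | zs₁ , zs₂ , refl , e₁ , e₂ = z ∷ zs₁ , zs₂ , refl , cong suc e₁ , e₂

decompose : ∀ (lam μ : List ℕ) {a b} (π : List ℕ) → length π ≡ length (a ∷ lam ++ b ∷ μ) →
            ∃[ a₀ ] ∃[ α ] ∃[ n ] ∃[ β ]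
              (π ≡ a₀ ∷ α ++ n ∷ β × length lam ≡ length α × length μ ≡ length β)
decompose lam μ (p ∷ π) e with ++-length⁻ lam π (suc-injective e)
... | α , n ∷ β , refl , e₁ , e₂ = p , α , n , β , refl , e₁ , suc-injective e₂

≢[]-length : ∀ {xs ys : List ℕ} → length xs ≡ length ys → xs ≢ [] → ys ≢ []
≢[]-length {[]} _ xs≢[] _ = xs≢[] refl
≢[]-length {_ ∷ _} {[]} () _ _

module _ {a lam b μ a₀ α n β}
         (iso : OrderIso′ (a ∷ lam ++ b ∷ μ) (a₀ ∷ α ++ n ∷ β))
         (|lam| : length lam ≡ length α) (|μ| : length μ ≡ length β)
         (below : All (_< b) (a ∷ lam ++ μ)) where

  raise : ∀ {z} → b ≤ z → OrderIso (a ∷ lam ++ z ∷ μ) (a₀ ∷ α ++ n ∷ β)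
  raise = OrderIso′⇒OrderIso ∘ OrderIso′-raise (a ∷ lam) (a₀ ∷ α) iso (cong suc |lam|) |μ| below

  Pattern⇒RShape : ∀ {σ} → Unique σ → Pattern a lam b μ σ → ∃[ w ] (RShape a₀ α n β w × w ⊆ σ)
  Pattern⇒RShape uσ (distinct f x l₁ y l₂ z refl a<x x<y x<z b≤y b≤z c p) =
    _ , (f , a , x , l₂ , z , μ , Unique-resp-⊇ p uσ , a<x ,
         inj₁ (l₁ , y , refl , c , |lam| , iso-z , bounds)) , p
    where
    iso-z : OrderIso (a ∷ l₁ ++ l₂ ++ z ∷ μ) (a₀ ∷ α ++ n ∷ β)
    iso-z = subst (λ r → OrderIso (a ∷ r) (a₀ ∷ α ++ n ∷ β)) (++-assoc l₁ l₂ (z ∷ μ)) (raise b≤z)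
    bounds : All (λ t → t < y × t < z) (a ∷ x ∷ l₁ ++ l₂ ++ μ)
    bounds with All.map (λ t<b → <-≤-trans t<b b≤y , <-≤-trans t<b b≤z) below
    ... | a<y∧z ∷ rest = a<y∧z ∷ (x<y , x<z) ∷ subst (All _) (++-assoc l₁ l₂ μ) rest
  Pattern⇒RShape uσ (same f x z a<x b≤x b≤z p) =
    _ , (f , a , x , lam , z , μ , Unique-resp-⊇ p uσ , a<x ,
         inj₂ (refl , |lam| , raise b≤z , bounds)) , p
    where
    bounds : All (λ t → t < x × t < z) (a ∷ lam ++ μ)
    bounds = All.map (λ t<b → <-≤-trans t<b b≤x , <-≤-trans t<b b≤z) below

occurrence⇒R : ∀ {σ a₀ α n β} → All (_< a₀) α → All (_< n) (a₀ ∷ α ++ β) → β ≢ [] →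
               ∃[ w ] (RShape a₀ α n β w × w ⊆ σ) →
               Σ[ ρ ∈ List ℕ ] (InR (a₀ ∷ α ++ n ∷ β) ρ × Σ[ s ∈ List ℕ ] (s ⊆ σ × OrderIso s ρ))
occurrence⇒R {a₀ = a₀} {α} {n} {β} α<a₀ π<n β≢[]
             (w , shape@(_ , _ , _ , _ , _ , _ , uw , _) , w⊆σ) =
  standardize w ,
  (a₀ , α , n , β , refl , α<a₀ , π<n , β≢[] , standardize-IsPerm w uw , w , shape ,
   OrderIso′⇒OrderIso (OrderIso′-sym (standardize-OrderIso′ w))) ,
  w , w⊆σ , OrderIso′⇒OrderIso (standardize-OrderIso′ w)

lemma2p8 : (σ : List ℕ) (a : ℕ) (lam : List ℕ) (b : ℕ) (μ : List ℕ) →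
    Unique σ → Unique (a ∷ lam ++ b ∷ μ) →
    lrMaxima (a ∷ lam ++ b ∷ μ) ≡ a ∷ b ∷ [] → μ ≢ [] →
    (τ : List ℕ) → BRel σ τ → (a ∷ lam ++ b ∷ μ) ⊆ τ →
    (π : List ℕ) → IsPerm π → OrderIso π (a ∷ lam ++ b ∷ μ) →
    Σ[ ρ ∈ List ℕ ] (InR π ρ × Σ[ s ∈ List ℕ ] (s ⊆ σ × OrderIso s ρ))
lemma2p8 σ a lam b μ uσ uX lrMax μ≢[] τ Bστ X⊆τ π _ π≅X
  with lam<a , a<b , μ<b ← two-lrMaxima {a} {lam} {b} {μ} uX lrMax
  with a₀ , α , n , β , refl , |lam| , |μ| ← decompose lam μ {a} {b} π (proj₁ π≅X)
  = occurrence⇒R α<a₀ π<n (≢[]-length |μ| μ≢[])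
      (Pattern⇒RShape iso |lam| |μ| below uσ (pattern-B Bστ X⊆τ (All.map <⇒≤ lam<a) μ<b μ≢[]))
  where
  iso : OrderIso′ (a ∷ lam ++ b ∷ μ) (a₀ ∷ α ++ n ∷ β)
  iso = OrderIso′-sym (OrderIso⇒OrderIso′ π≅X)
  below : All (_< b) (a ∷ lam ++ μ)
  below = a<b ∷ All.++⁺ (All.map (λ l<a → <-trans l<a a<b) lam<a) μ<b
  α<a₀ : All (_< a₀) α
  α<a₀ = OrderIso′-below iso (here refl) lam α |lam| (there ∘ ∈-zip-++⁺ˡ lam α |lam|) lam<a
  π<n : All (_< n) (a₀ ∷ α ++ β)
  π<n = OrderIso′-max (a ∷ lam) (a₀ ∷ α) iso (cong suc |lam|) |μ| below
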